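{- Let $p$ be a prime number and, for $n\ge 1$, let $r(p,n)$ denote the number of orbits of the left action of $\mathrm{SL}(2,\mathbb{Z})$ on $(\mathbb{Z}_p\times\mathbb{Z}_p)^n$, and set $F(p,n)=r(p,n+1)-r(p,n)$. Then for every $n\in\mathbb{N}$, $n\ge1$, $F(p,n)=p^{n-1}(p^n+p-1)$.
   Context: Elements of $(\mathbb{Z}_p\times\mathbb{Z}_p)^n$ are viewed as $2\times n$ matrices over $\mathbb{Z}_p$, and $S\in\mathrm{SL}(2,\mathbb{Z})$ acts by left matrix multiplication with the entries of $S$ reduced modulo $p$. -}

module Defs where

open import Data.Nat as ℕ using (ℕ)
open import Data.Integer using (ℤ; +_; _+_; _-_; _*_)
open import Data.Integer.Divisibility using (_∣_)
open import Data.Fin using (Fin; zero; suc; toℕ)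
open import Data.Product using (Σ; _×_)
open import Relation.Binary.PropositionalEquality using (_≡_)

record SL2Z : Set where
  field
    a b c d : ℤ
    det : a * d - b * c ≡ + 1

-- ℤ_p represented by canonical residues Fin p = {0,…,p-1}
Zp : ℕ → Set
Zp p = Fin p

-- an element of (ℤ_p × ℤ_p)^n as a 2 × n matrix over ℤ_p
Mat : ℕ → ℕ → Set
Mat p n = Fin 2 → Fin n → Zp p

lift : {p : ℕ} → Zp p → ℤ
lift x = + toℕ x

entry : SL2Z → Fin 2 → Fin 2 → ℤ
entry S zero zero = SL2Z.a S
entry S zero (suc zero) = SL2Z.b S
entry S (suc zero) zero = SL2Z.c S
entry S (suc zero) (suc zero) = SL2Z.d S

actℤ : {p n : ℕ} → SL2Z → Mat p n → Fin 2 → Fin n → ℤ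
actℤ S x i j = entry S i zero * lift (x zero j) + entry S i (suc zero) * lift (x (suc zero) j)

-- S · x = y in (ℤ_p × ℤ_p)^n, i.e. entrywise congruence modulo p
_·_≈_ : {p n : ℕ} → SL2Z → Mat p n → Mat p n → Set
_·_≈_ {p} S x y = ∀ i j → (+ p) ∣ (actℤ S x i j - lift (y i j))

SameOrbit : {p n : ℕ} → Mat p n → Mat p n → Set
SameOrbit x y = Σ SL2Z λ S → S · x ≈ y

NumOrbits : (p n k : ℕ) → Set
NumOrbits p n k =
  Σ (Fin k → Mat p n) λ rep →
    (∀ (x : Mat p n) → Σ (Fin k) λ i → SameOrbit (rep i) x) ×
    (∀ (i j : Fin k) → SameOrbit (rep i) (rep j) → i ≡ j)

-- Orbits are counted column by column, along the chain SL₂(ℤ) ⊇ Γ₁(p) ⊇ Γ(p) of stabilisers mod p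
-- (of e₁, and of every vector). If the first column is zero, the orbit is an SL₂-orbit of the other
-- columns; otherwise SL₂ moves the first column to e₁ (it is transitive on nonzero vectors of 𝔽ₚ²),
-- and what remains is a Γ₁-orbit of the other columns. Likewise Γ₁ fixes a first column (a, 0) and
-- moves any (a, s) with s ≠ 0 to (0, s), whose stabiliser in Γ₁ is Γ, which acts trivially. So if
-- r, r₁, r₀ count the orbits of SL₂, Γ₁, Γ on n columns, then r₀(n) = p²ⁿ and
--   r(n+1) = r(n) + r₁(n),   r₁(n+1) = p r₁(n) + (p − 1) r₀(n),
-- whence F(p, n) = r₁(n) = pⁿ⁻¹(pⁿ + p − 1).

module Submission where

open import Defs
open import Data.Nat as ℕ using (ℕ; zero; suc; NonZero)
import Data.Nat.Properties as ℕₚ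
import Data.Nat.Divisibility as ℕ∣
open import Data.Nat.Primality using (Prime; ¬prime[0]; ¬prime[1])
open import Data.Nat.Coprimality using (prime⇒coprime; coprime-Bézout)
open import Data.Nat.GCD using (module Bézout)
open import Data.Fin using (Fin; zero; suc; toℕ; fromℕ<)
import Data.Fin.Properties as Finₚ
open import Data.Product using (Σ; _×_; _,_; map)
open import Data.Product.Function.NonDependent.Propositional using (_×-↔_)
open import Data.Sum using (_⊎_; inj₁; inj₂; [_,_]′)
open import Data.Sum.Function.Propositional using (_⊎-↔_)
open import Data.Unit using (⊤; tt)
open import Function using (id; _∘_; _↔_; Inverse)
open import Function.Construct.Composition using (_↔-∘_)
open import Function.Construct.Identity using (↔-id)
open import Data.Vec.Functional.Relation.Binary.Pointwise using (Pointwise)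
import Data.Vec.Functional.Relation.Binary.Pointwise.Properties as Pointwise
open import Relation.Binary.Bundles using (Setoid)
open import Relation.Binary.Definitions using (Reflexive; Symmetric; Transitive)
open import Relation.Binary.PropositionalEquality
import Relation.Binary.Reasoning.Setoid as SetoidReasoning
open import Relation.Nullary using (¬_; contradiction)

module _ where
  open import Data.Integer as ℤ using (ℤ; +_; 0ℤ; 1ℤ; _+_; _*_; _-_; -_)
  import Data.Integer.Properties as ℤₚ
  open import Data.Integer.Divisibility.Signed using (_∣_; divides; ∣⇒∣ᵤ; ∣ᵤ⇒∣; ∣m∣n⇒∣m+n; ∣m⇒∣-m; ∣m⇒∣m*n; ∣n⇒∣m*n)
  open import Data.Integer.DivMod using (_%ℕ_; _/ℕ_; n%ℕd<d; a≡a%ℕn+[a/ℕn]*n)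
  open import Data.Integer.Tactic.RingSolver using (solve-∀)

  module Congruence (m : ℕ) where

    infix 4 _≋_ _≋ᶜ_

    record _≋_ (a b : ℤ) : Set where
      constructor mk≋
      field modulus∣difference : + m ∣ a - b

    ≋-refl : Reflexive _≋_
    ≋-refl {a} = mk≋ (divides 0ℤ (ℤₚ.+-inverseʳ a))

    ≋-reflexive : ∀ {a b} → a ≡ b → a ≋ b
    ≋-reflexive refl = ≋-refl

    ≋-sym : Symmetric _≋_
    ≋-sym {a} {b} (mk≋ m∣a-b) = mk≋ (subst (+ m ∣_) (negated a b) (∣m⇒∣-m m∣a-b))
      where
      negated : ∀ a b → - (a - b) ≡ b - a
      negated = solve-∀

    ≋-trans : Transitive _≋_
    ≋-trans {a} {b} {c} (mk≋ m∣a-b) (mk≋ m∣b-c) = mk≋ (subst (+ m ∣_) (telescope a b c) (∣m∣n⇒∣m+n m∣a-b m∣b-c))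
      where
      telescope : ∀ a b c → (a - b) + (b - c) ≡ a - c
      telescope = solve-∀

    ≋-setoid : Setoid _ _
    ≋-setoid = record
      { _≈_ = _≋_
      ; isEquivalence = record { refl = ≋-refl ; sym = ≋-sym ; trans = ≋-trans }
      }

    +-cong : ∀ {a b c d} → a ≋ b → c ≋ d → a + c ≋ b + d
    +-cong {a} {b} {c} {d} (mk≋ m∣a-b) (mk≋ m∣c-d) =
      mk≋ (subst (+ m ∣_) (regroup a b c d) (∣m∣n⇒∣m+n m∣a-b m∣c-d))
      where
      regroup : ∀ a b c d → (a - b) + (c - d) ≡ (a + c) - (b + d)
      regroup = solve-∀

    *-cong : ∀ {a b c d} → a ≋ b → c ≋ d → a * c ≋ b * d
    *-cong {a} {b} {c} {d} (mk≋ m∣a-b) (mk≋ m∣c-d) =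
      mk≋ (subst (+ m ∣_) (regroup a b c d) (∣m∣n⇒∣m+n (∣m⇒∣m*n c m∣a-b) (∣n⇒∣m*n b m∣c-d)))
      where
      regroup : ∀ a b c d → (a - b) * c + b * (c - d) ≡ a * c - b * d
      regroup = solve-∀

    -‿cong : ∀ {a b} → a ≋ b → - a ≋ - b
    -‿cong {a} {b} (mk≋ m∣a-b) = mk≋ (subst (+ m ∣_) (negated a b) (∣m⇒∣-m m∣a-b))
      where
      negated : ∀ a b → - (a - b) ≡ - a - - b
      negated = solve-∀

    modulus≋0 : + m ≋ 0ℤ
    modulus≋0 = mk≋ (divides 1ℤ (trans (ℤₚ.+-identityʳ (+ m)) (sym (ℤₚ.*-identityˡ (+ m)))))

    _≋ᶜ_ : (Fin 2 → ℤ) → (Fin 2 → ℤ) → Set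
    _≋ᶜ_ = Pointwise _≋_

    open Setoid (Pointwise.setoid ≋-setoid 2) public
      using () renaming (sym to ≋ᶜ-sym; trans to ≋ᶜ-trans)

    ≋ᶜ-reflexive : ∀ {u v} → u ≗ v → u ≋ᶜ v
    ≋ᶜ-reflexive u≗v i = ≋-reflexive (u≗v i)

    module ≋-Reasoning = SetoidReasoning ≋-setoid
    module ≋ᶜ-Reasoning = SetoidReasoning (Pointwise.setoid ≋-setoid 2)

  module Residues (m : ℕ) .{{_ : NonZero m}} where
    open Congruence m

    private
      divisor-of-smaller : ∀ {d} → m ℕ∣.∣ d → d ℕ.< m → d ≡ 0
      divisor-of-smaller {zero}  _   _   = refl
      divisor-of-smaller {suc d} m∣d d<m = contradiction m∣d (ℕ∣.>⇒∤ d<m)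

    lift-injective : ∀ {x y : Fin m} → lift x ≋ lift y → x ≡ y
    lift-injective {x} {y} (mk≋ m∣x-y) =
      Finₚ.toℕ-injective (ℤₚ.+-injective (ℤₚ.i-j≡0⇒i≡j _ _ (ℤₚ.∣i∣≡0⇒i≡0
        (divisor-of-smaller (∣⇒∣ᵤ m∣x-y) distance<m))))
      where
      distance<m : ℤ.∣ lift x - lift y ∣ ℕ.< m
      distance<m = subst (ℕ._< m) (cong ℤ.∣_∣ (sym (ℤₚ.m-n≡m⊖n (toℕ x) (toℕ y))))
        (ℕₚ.≤-<-trans (ℤₚ.∣m⊝n∣≤m⊔n (toℕ x) (toℕ y)) (ℕₚ.⊔-lub (Finₚ.toℕ<n x) (Finₚ.toℕ<n y)))

    reduce : ℤ → Fin m
    reduce z = fromℕ< (n%ℕd<d z m)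

    lift-reduce : ∀ z → lift (reduce z) ≋ z
    lift-reduce z = ≋-sym (mk≋ (divides (z /ℕ m) (begin
      z - lift (reduce z)                         ≡⟨ cong₂ _-_ (a≡a%ℕn+[a/ℕn]*n z m) (cong +_ (Finₚ.toℕ-fromℕ< _)) ⟩
      (+ (z %ℕ m) + z /ℕ m * + m) - + (z %ℕ m)    ≡⟨ cancel (+ (z %ℕ m)) (z /ℕ m * + m) ⟩
      z /ℕ m * + m                                ∎)))
      where
      open ≡-Reasoning
      cancel : ∀ r s → (r + s) - r ≡ s
      cancel = solve-∀

  module Units (q : ℕ) (isPrime : Prime (suc q)) where
    open Congruence (suc q)

    private
      bézout-in-ℤ : ∀ a b c d → suc (a ℕ.* b) ≡ c ℕ.* d → 1ℤ + + a * + b ≡ + c * + d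
      bézout-in-ℤ a b c d eq = begin
        1ℤ + + a * + b   ≡⟨ cong (λ n → 1ℤ + n) (ℤₚ.pos-* a b) ⟨
        + suc (a ℕ.* b)  ≡⟨ cong +_ eq ⟩
        + (c ℕ.* d)      ≡⟨ ℤₚ.pos-* c d ⟩
        + c * + d        ∎
        where open ≡-Reasoning

    lift-suc-invertible : (y : Fin q) → Σ ℤ λ u → lift (suc y) * u ≋ 1ℤ
    lift-suc-invertible y with coprime-Bézout (prime⇒coprime isPrime (Finₚ.toℕ<n (suc y)))
    ... | Bézout.+- a b eq = - + b , mk≋ (divides (- + a) (begin
      s * - + b - 1ℤ       ≡⟨ negate-sum s (+ b) ⟩
      - (1ℤ + + b * s)     ≡⟨ cong -_ (bézout-in-ℤ b (toℕ (suc y)) a (suc q) eq) ⟩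
      - (+ a * + suc q)    ≡⟨ ℤₚ.neg-distribˡ-* (+ a) (+ suc q) ⟩
      - + a * + suc q      ∎))
      where
      open ≡-Reasoning
      s = lift (suc y)
      negate-sum : ∀ s b → s * - b - 1ℤ ≡ - (1ℤ + b * s)
      negate-sum = solve-∀
    ... | Bézout.-+ a b eq = + b , mk≋ (divides (+ a) (begin
      s * + b - 1ℤ           ≡⟨ swap s (+ b) ⟩
      + b * s - 1ℤ           ≡⟨ cong (_- 1ℤ) (bézout-in-ℤ a (suc q) b (toℕ (suc y)) eq) ⟨
      1ℤ + + a * + suc q - 1ℤ ≡⟨ cancel (+ a * + suc q) ⟩
      + a * + suc q          ∎))
      where
      open ≡-Reasoning
      s = lift (suc y)
      swap : ∀ s b → s * b - 1ℤ ≡ b * s - 1ℤ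
      swap = solve-∀
      cancel : ∀ x → 1ℤ + x - 1ℤ ≡ x
      cancel = solve-∀

    lift-suc-cancel : ∀ {b} (y : Fin q) → b * lift (suc y) ≋ 0ℤ → b ≋ 0ℤ
    lift-suc-cancel {b} y bs≋0 with lift-suc-invertible y
    ... | u , su≋1 = begin
      b                    ≡⟨ ℤₚ.*-identityʳ b ⟨
      b * 1ℤ               ≈⟨ *-cong (≋-refl {b}) su≋1 ⟨
      b * (s * u)          ≡⟨ ℤₚ.*-assoc b s u ⟨
      b * s * u            ≈⟨ *-cong bs≋0 ≋-refl ⟩
      0ℤ                   ∎
      where
      open ≋-Reasoning
      s = lift (suc y)

  Column : Set
  Column = Fin 2 → ℤ

  infixr 7 _⊙_
  _⊙_ : SL2Z → Column → Column
  (S ⊙ u) i = entry S i zero * u zero + entry S i (suc zero) * u (suc zero)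

  I₂ : SL2Z
  I₂ = record { a = 1ℤ ; b = 0ℤ ; c = 0ℤ ; d = 1ℤ ; det = refl }

  infixl 8 _∙_
  _∙_ : SL2Z → SL2Z → SL2Z
  T ∙ S = record
    { a = A * a + B * c ; b = A * b + B * d
    ; c = C * a + D * c ; d = C * b + D * d
    ; det = trans (det-multiplicative A B C D a b c d) (cong₂ _*_ (SL2Z.det T) (SL2Z.det S))
    }
    where
    open SL2Z S
    open SL2Z T renaming (a to A; b to B; c to C; d to D) using ()
    det-multiplicative : ∀ A B C D a b c d →
      (A * a + B * c) * (C * b + D * d) - (A * b + B * d) * (C * a + D * c) ≡ (A * D - B * C) * (a * d - b * c)
    det-multiplicative = solve-∀

  infix 9 _⁻¹
  _⁻¹ : SL2Z → SL2Z
  S ⁻¹ = record { a = d ; b = - b ; c = - c ; d = a ; det = trans (adjugate-det a b c d) det }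
    where
    open SL2Z S
    adjugate-det : ∀ a b c d → d * a - - b * - c ≡ a * d - b * c
    adjugate-det = solve-∀

  ⊙-identity : ∀ u → I₂ ⊙ u ≗ u
  ⊙-identity u zero       = unit-row (u zero) (u (suc zero))
    where
    unit-row : ∀ x y → 1ℤ * x + 0ℤ * y ≡ x
    unit-row = solve-∀
  ⊙-identity u (suc zero) = unit-row (u zero) (u (suc zero))
    where
    unit-row : ∀ x y → 0ℤ * x + 1ℤ * y ≡ y
    unit-row = solve-∀

  private
    regroup : ∀ A B a b c d x y →
      (A * a + B * c) * x + (A * b + B * d) * y ≡ A * (a * x + b * y) + B * (c * x + d * y)
    regroup = solve-∀

  ⊙-∙ : ∀ T S u → (T ∙ S) ⊙ u ≗ T ⊙ (S ⊙ u)
  ⊙-∙ T S u zero       = regroup (SL2Z.a T) (SL2Z.b T) a b c d (u zero) (u (suc zero)) where open SL2Z S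
  ⊙-∙ T S u (suc zero) = regroup (SL2Z.c T) (SL2Z.d T) a b c d (u zero) (u (suc zero)) where open SL2Z S

  private
    scaled-by-det : ∀ S {e} x → e ≡ (SL2Z.a S * SL2Z.d S - SL2Z.b S * SL2Z.c S) * x → e ≡ x
    scaled-by-det S x eq = trans eq (trans (cong (_* x) (SL2Z.det S)) (ℤₚ.*-identityˡ x))

  ⊙-inverseʳ : ∀ S u → S ⊙ (S ⁻¹ ⊙ u) ≗ u
  ⊙-inverseʳ S u zero       = scaled-by-det S (u zero) (cramer a b c d (u zero) (u (suc zero)))
    where
    open SL2Z S
    cramer : ∀ a b c d x y → a * (d * x + - b * y) + b * (- c * x + a * y) ≡ (a * d - b * c) * x
    cramer = solve-∀
  ⊙-inverseʳ S u (suc zero) = scaled-by-det S (u (suc zero)) (cramer a b c d (u zero) (u (suc zero)))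
    where
    open SL2Z S
    cramer : ∀ a b c d x y → c * (d * x + - b * y) + d * (- c * x + a * y) ≡ (a * d - b * c) * y
    cramer = solve-∀

  ⊙-inverseˡ : ∀ S u → S ⁻¹ ⊙ (S ⊙ u) ≗ u
  ⊙-inverseˡ S u zero       = scaled-by-det S (u zero) (cramer a b c d (u zero) (u (suc zero)))
    where
    open SL2Z S
    cramer : ∀ a b c d x y → d * (a * x + b * y) + - b * (c * x + d * y) ≡ (a * d - b * c) * x
    cramer = solve-∀
  ⊙-inverseˡ S u (suc zero) = scaled-by-det S (u (suc zero)) (cramer a b c d (u zero) (u (suc zero)))
    where
    open SL2Z S
    cramer : ∀ a b c d x y → - c * (a * x + b * y) + a * (c * x + d * y) ≡ (a * d - b * c) * y
    cramer = solve-∀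

  module Action (p : ℕ) .{{_ : NonZero p}} where

    open Congruence p
    open Residues p

    Vector : Set
    Vector = Fin 2 → Fin p

    ⟦_⟧ : Vector → Column
    ⟦ v ⟧ i = lift (v i)

    ⟨_,_⟩ : Fin p → Fin p → Vector
    ⟨ x , y ⟩ zero       = x
    ⟨ x , y ⟩ (suc zero) = y

    ⟨,⟩-≗ : ∀ {x y} {v : Vector} → x ≡ v zero → y ≡ v (suc zero) → ∀ i → ⟨ x , y ⟩ i ≡ v i
    ⟨,⟩-≗ x≡v₀ y≡v₁ zero       = x≡v₀
    ⟨,⟩-≗ x≡v₀ y≡v₁ (suc zero) = y≡v₁

    ⟦⟧-injective : ∀ {v w} → ⟦ v ⟧ ≋ᶜ ⟦ w ⟧ → ∀ i → v i ≡ w i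
    ⟦⟧-injective v≋w i = lift-injective (v≋w i)

    column : ∀ {n} → Mat p n → Fin n → Vector
    column x j i = x i j

    infixr 5 _∷ᶜ_
    _∷ᶜ_ : ∀ {n} → Vector → Mat p n → Mat p (suc n)
    (v ∷ᶜ x) i zero    = v i
    (v ∷ᶜ x) i (suc j) = x i j

    tail : ∀ {n} → Mat p (suc n) → Mat p n
    tail x i j = x i (suc j)

    act : ∀ {n} → SL2Z → Mat p n → Mat p n
    act S x i j = reduce ((S ⊙ ⟦ column x j ⟧) i)

    Maps : ∀ {n} → SL2Z → Mat p n → Mat p n → Set
    Maps S x y = ∀ j → S ⊙ ⟦ column x j ⟧ ≋ᶜ ⟦ column y j ⟧

    ⊙-congʳ : ∀ S {u v} → u ≋ᶜ v → S ⊙ u ≋ᶜ S ⊙ v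
    ⊙-congʳ S u≋v i = +-cong (*-cong (≋-refl {entry S i zero}) (u≋v zero))
                            (*-cong (≋-refl {entry S i (suc zero)}) (u≋v (suc zero)))

    ⊙-congˡ : ∀ {S T} → (∀ i k → entry S i k ≋ entry T i k) → ∀ u → S ⊙ u ≋ᶜ T ⊙ u
    ⊙-congˡ S≋T u i = +-cong (*-cong (S≋T i zero) (≋-refl {u zero}))
                             (*-cong (S≋T i (suc zero)) (≋-refl {u (suc zero)}))

    cancel-⁻¹ : ∀ S {u v} → S ⊙ u ≋ᶜ v → u ≋ᶜ S ⁻¹ ⊙ v
    cancel-⁻¹ S {u} {v} Su≋v = begin
      u                  ≈⟨ ≋ᶜ-reflexive (⊙-inverseˡ S u) ⟨
      S ⁻¹ ⊙ (S ⊙ u)     ≈⟨ ⊙-congʳ (S ⁻¹) Su≋v ⟩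
      S ⁻¹ ⊙ v           ∎
      where open ≋ᶜ-Reasoning

    maps-∙ : ∀ {n S T} {x y z : Mat p n} → Maps T x y → Maps S y z → Maps (S ∙ T) x z
    maps-∙ {S = S} {T} {x} {y} {z} Tx≋y Sy≋z j = begin
      S ∙ T ⊙ ⟦ column x j ⟧     ≈⟨ ≋ᶜ-reflexive (⊙-∙ S T ⟦ column x j ⟧) ⟩
      S ⊙ (T ⊙ ⟦ column x j ⟧)   ≈⟨ ⊙-congʳ S (Tx≋y j) ⟩
      S ⊙ ⟦ column y j ⟧         ≈⟨ Sy≋z j ⟩
      ⟦ column z j ⟧             ∎
      where open ≋ᶜ-Reasoning

    maps-⁻¹ : ∀ {n S} {x y : Mat p n} → Maps S x y → Maps (S ⁻¹) y x
    maps-⁻¹ {S = S} Sx≋y j = ≋ᶜ-sym (cancel-⁻¹ S (Sx≋y j))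

    maps-act : ∀ {n} S (x : Mat p n) → Maps S (act (S ⁻¹) x) x
    maps-act S x j = begin
      S ⊙ ⟦ column (act (S ⁻¹) x) j ⟧   ≈⟨ ⊙-congʳ S (λ i → lift-reduce ((S ⁻¹ ⊙ ⟦ column x j ⟧) i)) ⟩
      S ⊙ (S ⁻¹ ⊙ ⟦ column x j ⟧)       ≈⟨ ≋ᶜ-reflexive (⊙-inverseʳ S _) ⟩
      ⟦ column x j ⟧                    ∎
      where open ≋ᶜ-Reasoning

    Fixes : Column → SL2Z → Set
    Fixes u S = S ⊙ u ≋ᶜ u

    Fixes-I₂ : ∀ {u} → Fixes u I₂
    Fixes-I₂ {u} = ≋ᶜ-reflexive (⊙-identity u)

    I₂-⊙-≗ : ∀ {v w} → (∀ i → v i ≡ w i) → I₂ ⊙ ⟦ v ⟧ ≋ᶜ ⟦ w ⟧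
    I₂-⊙-≗ v≗w = ≋ᶜ-trans Fixes-I₂ (≋ᶜ-reflexive (cong lift ∘ v≗w))

    Fixes-∙ : ∀ {u} S T → Fixes u S → Fixes u T → Fixes u (S ∙ T)
    Fixes-∙ {u} S T Su≋u Tu≋u = begin
      S ∙ T ⊙ u      ≈⟨ ≋ᶜ-reflexive (⊙-∙ S T u) ⟩
      S ⊙ (T ⊙ u)    ≈⟨ ⊙-congʳ S Tu≋u ⟩
      S ⊙ u          ≈⟨ Su≋u ⟩
      u              ∎
      where open ≋ᶜ-Reasoning

    Fixes-⁻¹ : ∀ {u S} → Fixes u S → Fixes u (S ⁻¹)
    Fixes-⁻¹ {S = S} Su≋u = ≋ᶜ-sym (cancel-⁻¹ S Su≋u)

    Full : SL2Z → Set
    Full _ = ⊤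

    Orbit : (SL2Z → Set) → ∀ {n} → Mat p n → Mat p n → Set
    Orbit G x y = Σ SL2Z λ S → G S × Maps S x y

    orbit-sym : ∀ {G n} {x y : Mat p n} → (∀ {S} → G S → G (S ⁻¹)) → Orbit G x y → Orbit G y x
    orbit-sym G-⁻¹ (S , g , Sx≋y) = S ⁻¹ , G-⁻¹ g , maps-⁻¹ Sx≋y

    orbit-tail : ∀ {G n v w} {x y : Mat p n} → Orbit G (v ∷ᶜ x) (w ∷ᶜ y) → Orbit G x y
    orbit-tail (S , g , Sx≋y) = S , g , Sx≋y ∘ suc

    record Transversal (G : SL2Z → Set) (n : ℕ) (I : Set) : Set where
      field
        rep      : I → Mat p n
        cover    : ∀ x → Σ I λ i → Orbit G (rep i) x
        separate : ∀ i j → Orbit G (rep i) (rep j) → i ≡ j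

    open Transversal public

    reindex : ∀ {G n I J} → I ↔ J → Transversal G n J → Transversal G n I
    reindex {G} {n} {I} {J} I↔J T = record
      { rep      = rep T ∘ to
      ; cover    = λ x → map from (subst (λ j → Orbit G (rep T j) x) (sym (strictlyInverseˡ _))) (cover T x)
      ; separate = λ i j o → begin
          i            ≡⟨ strictlyInverseʳ i ⟨
          from (to i)  ≡⟨ cong from (separate T (to i) (to j) o) ⟩
          from (to j)  ≡⟨ strictlyInverseʳ j ⟩
          j            ∎
      }
      where
      open Inverse I↔J
      open ≡-Reasoning

    empty-transversal : ∀ {G} → G I₂ → Transversal G 0 ⊤
    empty-transversal g = record
      { rep      = λ _ _ ()
      ; cover    = λ x → tt , I₂ , g , λ ()
      ; separate = λ _ _ _ → refl
      }

    -- The common shape of the covering arguments: S₀ moves v to the first column of x, and the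
    -- remaining columns are covered by a group H fixing v.
    cover-∷ : ∀ {G H n I} (T : Transversal H n I) {v S₀} {x : Mat p (suc n)} →
      (∀ {S} → H S → G (S₀ ∙ S)) → (∀ {S} → H S → Fixes ⟦ v ⟧ S) →
      S₀ ⊙ ⟦ v ⟧ ≋ᶜ ⟦ column x zero ⟧ → Σ I λ i → Orbit G (v ∷ᶜ rep T i) x
    cover-∷ T {v} {S₀} {x} closed fixes S₀v≋x₀ with cover T (tail (act (S₀ ⁻¹) x))
    ... | i , S , h , tail-maps = i , S₀ ∙ S , closed h , maps-∙ {x = v ∷ᶜ rep T i} maps-y (maps-act S₀ x)
      where
      y = act (S₀ ⁻¹) x
      maps-y : Maps S (v ∷ᶜ rep T i) y
      maps-y zero = begin
        S ⊙ ⟦ v ⟧                   ≈⟨ fixes h ⟩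
        ⟦ v ⟧                       ≈⟨ cancel-⁻¹ S₀ S₀v≋x₀ ⟩
        S₀ ⁻¹ ⊙ ⟦ column x zero ⟧   ≈⟨ (λ i → lift-reduce _) ⟨
        ⟦ column y zero ⟧           ∎
        where open ≋ᶜ-Reasoning
      maps-y (suc j) = tail-maps j

    Maps⇒· : ∀ {n S} {x y : Mat p n} → Maps S x y → S · x ≈ y
    Maps⇒· maps i j = ∣⇒∣ᵤ (_≋_.modulus∣difference (maps j i))

    ·⇒Maps : ∀ {n S} {x y : Mat p n} → S · x ≈ y → Maps S x y
    ·⇒Maps S·x≈y j i = mk≋ (∣ᵤ⇒∣ (S·x≈y i j))

    numOrbits : ∀ {n k} → Transversal Full n (Fin k) → NumOrbits p n k
    numOrbits {n} {k} T = rep T , cover′ , separate′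
      where
      cover′ : ∀ x → Σ (Fin k) λ i → SameOrbit (rep T i) x
      cover′ x with cover T x
      ... | i , S , _ , maps = i , S , Maps⇒· {x = rep T i} maps
      separate′ : ∀ i j → SameOrbit (rep T i) (rep T j) → i ≡ j
      separate′ i j (S , S·x≈y) = separate T i j (S , tt , ·⇒Maps {x = rep T i} S·x≈y)

  module Counts (p : ℕ) where

    countΓ : ℕ → ℕ
    countΓ zero    = 1
    countΓ (suc n) = p ℕ.* p ℕ.* countΓ n

    countΓ₁ : ℕ → ℕ
    countΓ₁ zero    = 1
    countΓ₁ (suc n) = p ℕ.* countΓ₁ n ℕ.+ (p ℕ.∸ 1) ℕ.* countΓ n

    countSL₂ : ℕ → ℕ
    countSL₂ zero    = 1
    countSL₂ (suc n) = countSL₂ n ℕ.+ countΓ₁ n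

  module Orbits (r : ℕ) (isPrime : Prime (suc (suc r))) where

    p q : ℕ
    p = suc (suc r)
    q = suc r

    open Congruence p
    open Residues p
    open Units q isPrime
    open Counts p
    open Action p

    0ᵥ e₁ : Vector
    0ᵥ = λ _ → zero
    e₁ = ⟨ suc zero , zero ⟩

    Γ₁ Γ : SL2Z → Set
    Γ₁   = Fixes ⟦ e₁ ⟧
    Γ S  = ∀ u → Fixes u S

    ⊙-0ᵥ : ∀ S → S ⊙ ⟦ 0ᵥ ⟧ ≗ ⟦ 0ᵥ ⟧
    ⊙-0ᵥ S i = annihilate (entry S i zero) (entry S i (suc zero))
      where
      annihilate : ∀ A B → A * 0ℤ + B * 0ℤ ≡ 0ℤ
      annihilate = solve-∀

    ⊙-e₁ : ∀ S i → (S ⊙ ⟦ e₁ ⟧) i ≡ entry S i zero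
    ⊙-e₁ S i = first (entry S i zero) (entry S i (suc zero))
      where
      first : ∀ A B → A * 1ℤ + B * 0ℤ ≡ A
      first = solve-∀

    ⊙-e₂ : ∀ S y i → (S ⊙ ⟦ ⟨ zero , y ⟩ ⟧) i ≡ entry S i (suc zero) * lift y
    ⊙-e₂ S y i = second (entry S i zero) (entry S i (suc zero)) (lift y)
      where
      second : ∀ A B Y → A * 0ℤ + B * Y ≡ B * Y
      second = solve-∀

    Γ₁-fixes-axis : ∀ {S} x → Γ₁ S → Fixes ⟦ ⟨ x , zero ⟩ ⟧ S
    Γ₁-fixes-axis {S} x g i = begin
      (S ⊙ ⟦ ⟨ x , zero ⟩ ⟧) i   ≡⟨ scale (entry S i zero) (entry S i (suc zero)) (lift x) ⟩
      (S ⊙ ⟦ e₁ ⟧) i * lift x    ≈⟨ *-cong (g i) (≋-refl {lift x}) ⟩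
      ⟦ e₁ ⟧ i * lift x          ≡⟨ axis i ⟩
      lift (⟨ x , zero ⟩ i)      ∎
      where
      open ≋-Reasoning
      scale : ∀ A B X → A * X + B * 0ℤ ≡ (A * 1ℤ + B * 0ℤ) * X
      scale = solve-∀
      axis : ∀ i → ⟦ e₁ ⟧ i * lift x ≡ lift (⟨ x , zero ⟩ i)
      axis zero       = ℤₚ.*-identityˡ (lift x)
      axis (suc zero) = refl

    Γ₁⇒a≋1 : ∀ {S} → Γ₁ S → SL2Z.a S ≋ 1ℤ
    Γ₁⇒a≋1 {S} g = ≋-trans (≋-reflexive (sym (⊙-e₁ S zero))) (g zero)

    Γ₁⇒c≋0 : ∀ {S} → Γ₁ S → SL2Z.c S ≋ 0ℤ
    Γ₁⇒c≋0 {S} g = ≋-trans (≋-reflexive (sym (⊙-e₁ S (suc zero)))) (g (suc zero))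

    Γ₁⇒d≋1 : ∀ {S} → Γ₁ S → SL2Z.d S ≋ 1ℤ
    Γ₁⇒d≋1 {S} g = begin
      d                ≡⟨ expand b d ⟩
      1ℤ * d - b * 0ℤ  ≈⟨ +-cong (*-cong (Γ₁⇒a≋1 g) (≋-refl {d})) (-‿cong (*-cong (≋-refl {b}) (Γ₁⇒c≋0 g))) ⟨
      a * d - b * c    ≡⟨ det ⟩
      1ℤ               ∎
      where
      open SL2Z S
      open ≋-Reasoning
      expand : ∀ b d → d ≡ 1ℤ * d - b * 0ℤ
      expand = solve-∀

    Γ-intro : ∀ {S} → Γ₁ S → SL2Z.b S ≋ 0ℤ → Γ S
    Γ-intro {S} g b≋0 u = ≋ᶜ-trans (⊙-congˡ S≋I₂ u) Fixes-I₂
      where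
      S≋I₂ : ∀ i k → entry S i k ≋ entry I₂ i k
      S≋I₂ zero       zero       = Γ₁⇒a≋1 g
      S≋I₂ zero       (suc zero) = b≋0
      S≋I₂ (suc zero) zero       = Γ₁⇒c≋0 g
      S≋I₂ (suc zero) (suc zero) = Γ₁⇒d≋1 g

    Γ-step : ∀ {n I} → Transversal Γ n I → Transversal Γ (suc n) ((Fin p × Fin p) × I)
    Γ-step {n} {I} T = record { rep = rep′ ; cover = cover′ ; separate = separate′ }
      where
      rep′ : (Fin p × Fin p) × I → Mat p (suc n)
      rep′ ((a , b) , i) = ⟨ a , b ⟩ ∷ᶜ rep T i

      cover′ : ∀ x → Σ _ λ k → Orbit Γ (rep′ k) x
      cover′ x = map ((x zero zero , x (suc zero) zero) ,_) id
        (cover-∷ T {v = ⟨ x zero zero , x (suc zero) zero ⟩} {S₀ = I₂}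
          (λ {S} g u → Fixes-∙ I₂ S Fixes-I₂ (g u)) (λ g → g _) (I₂-⊙-≗ (⟨,⟩-≗ refl refl)))

      separate′ : ∀ k l → Orbit Γ (rep′ k) (rep′ l) → k ≡ l
      separate′ ((a , b) , i) ((a′ , b′) , j) o@(S , g , maps) =
        cong₂ _,_ (cong₂ _,_ (same-head zero) (same-head (suc zero))) (separate T i j (orbit-tail o))
        where
        same-head : ∀ k → ⟨ a , b ⟩ k ≡ ⟨ a′ , b′ ⟩ k
        same-head = ⟦⟧-injective (≋ᶜ-trans (≋ᶜ-sym (g _)) (maps zero))

    shear : ℤ → SL2Z
    shear t = record { a = 1ℤ ; b = t ; c = 0ℤ ; d = 1ℤ ; det = unimodular t }
      where
      unimodular : ∀ t → 1ℤ * 1ℤ - t * 0ℤ ≡ 1ℤ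
      unimodular = solve-∀

    shear∈Γ₁ : ∀ t → Γ₁ (shear t)
    shear∈Γ₁ t zero       = ≋-reflexive (⊙-e₁ (shear t) zero)
    shear∈Γ₁ t (suc zero) = ≋-reflexive (⊙-e₁ (shear t) (suc zero))

    shear-reaches : ∀ w y → Σ ℤ λ t → shear t ⊙ ⟦ ⟨ zero , suc y ⟩ ⟧ ≋ᶜ ⟦ ⟨ w , suc y ⟩ ⟧
    shear-reaches w y with lift-suc-invertible y
    ... | u , su≋1 = lift w * u , moved
      where
      s : ℤ
      s = lift (suc y)
      moved : shear (lift w * u) ⊙ ⟦ ⟨ zero , suc y ⟩ ⟧ ≋ᶜ ⟦ ⟨ w , suc y ⟩ ⟧
      moved zero = begin
        (shear (lift w * u) ⊙ ⟦ ⟨ zero , suc y ⟩ ⟧) zero   ≡⟨ ⊙-e₂ (shear (lift w * u)) (suc y) zero ⟩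
        lift w * u * s                                     ≡⟨ ℤₚ.*-assoc (lift w) u s ⟩
        lift w * (u * s)                                   ≡⟨ cong (lift w *_) (ℤₚ.*-comm u s) ⟩
        lift w * (s * u)                                   ≈⟨ *-cong (≋-refl {lift w}) su≋1 ⟩
        lift w * 1ℤ                                        ≡⟨ ℤₚ.*-identityʳ (lift w) ⟩
        lift w                                             ∎
        where open ≋-Reasoning
      moved (suc zero) = ≋-reflexive (trans (⊙-e₂ (shear (lift w * u)) (suc y) (suc zero)) (ℤₚ.*-identityˡ s))

    Γ₁-step : ∀ {n J K} → Transversal Γ₁ n J → Transversal Γ n K →
              Transversal Γ₁ (suc n) ((Fin p × J) ⊎ (Fin q × K))
    Γ₁-step {n} {J} {K} T₁ T = record { rep = rep′ ; cover = cover′ ; separate = separate′ }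
      where
      rep′ : (Fin p × J) ⊎ (Fin q × K) → Mat p (suc n)
      rep′ (inj₁ (a , j)) = ⟨ a , zero ⟩ ∷ᶜ rep T₁ j
      rep′ (inj₂ (y , k)) = ⟨ zero , suc y ⟩ ∷ᶜ rep T k

      cover-by-x₁₀ : ∀ x c → c ≡ x (suc zero) zero → Σ ((Fin p × J) ⊎ (Fin q × K)) λ k → Orbit Γ₁ (rep′ k) x
      cover-by-x₁₀ x zero x₁₀≡ = map (λ j → inj₁ (x zero zero , j)) id
        (cover-∷ T₁ {v = ⟨ x zero zero , zero ⟩} {S₀ = I₂} (λ {S} → Fixes-∙ I₂ S Fixes-I₂) (Γ₁-fixes-axis _)
          (I₂-⊙-≗ (⟨,⟩-≗ refl x₁₀≡)))
      cover-by-x₁₀ x (suc y) x₁₀≡ with shear-reaches (x zero zero) y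
      ... | t , moved = map (λ k → inj₂ (y , k)) id
        (cover-∷ T {v = ⟨ zero , suc y ⟩} {S₀ = shear t} (λ {S} g → Fixes-∙ (shear t) S (shear∈Γ₁ t) (g _))
          (λ g → g _) (≋ᶜ-trans moved (≋ᶜ-reflexive (cong lift ∘ ⟨,⟩-≗ refl x₁₀≡))))

      cover′ : ∀ x → Σ ((Fin p × J) ⊎ (Fin q × K)) λ k → Orbit Γ₁ (rep′ k) x
      cover′ x = cover-by-x₁₀ x (x (suc zero) zero) refl

      x-axis-not-in-orbit-of-y-axis : ∀ {a j y k} → ¬ Orbit Γ₁ (rep′ (inj₁ (a , j))) (rep′ (inj₂ (y , k)))
      x-axis-not-in-orbit-of-y-axis {a} (S , g , maps) =
        contradiction (⟦⟧-injective (≋ᶜ-trans (≋ᶜ-sym (Γ₁-fixes-axis a g)) (maps zero)) (suc zero)) λ ()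

      separate′ : ∀ k l → Orbit Γ₁ (rep′ k) (rep′ l) → k ≡ l
      separate′ (inj₁ (a , i)) (inj₁ (a′ , j)) o@(S , g , maps) =
        cong inj₁ (cong₂ _,_ (⟦⟧-injective (≋ᶜ-trans (≋ᶜ-sym (Γ₁-fixes-axis a g)) (maps zero)) zero)
                             (separate T₁ i j (orbit-tail o)))
      separate′ (inj₁ _) (inj₂ _) o = contradiction o x-axis-not-in-orbit-of-y-axis
      separate′ (inj₂ _) (inj₁ _) o = contradiction (orbit-sym Fixes-⁻¹ o) x-axis-not-in-orbit-of-y-axis
      separate′ (inj₂ (y , i)) (inj₂ (y′ , j)) (S , g , maps) =
        cong inj₂ (cong₂ _,_ (Finₚ.suc-injective (lift-injective s≋s′))
                             (separate T i j (S , Γ-intro g b≋0 , maps ∘ suc)))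
        where
        open SL2Z S
        open ≋-Reasoning
        s s′ : ℤ
        s  = lift (suc y)
        s′ = lift (suc y′)
        s≋s′ : s ≋ s′
        s≋s′ = begin
          s                                  ≡⟨ ℤₚ.*-identityˡ s ⟨
          1ℤ * s                             ≈⟨ *-cong (Γ₁⇒d≋1 g) (≋-refl {s}) ⟨
          d * s                              ≡⟨ ⊙-e₂ S (suc y) (suc zero) ⟨
          (S ⊙ ⟦ ⟨ zero , suc y ⟩ ⟧) (suc zero) ≈⟨ maps zero (suc zero) ⟩
          s′                                 ∎
        b≋0 : b ≋ 0ℤ
        b≋0 = lift-suc-cancel y (begin
          b * s                              ≡⟨ ⊙-e₂ S (suc y) zero ⟨
          (S ⊙ ⟦ ⟨ zero , suc y ⟩ ⟧) zero    ≈⟨ maps zero zero ⟩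
          0ℤ                                 ∎)

    first-column : ∀ S {x y} → entry S zero zero ≋ lift x → entry S (suc zero) zero ≋ lift y →
                   S ⊙ ⟦ e₁ ⟧ ≋ᶜ ⟦ ⟨ x , y ⟩ ⟧
    first-column S a≋x c≋y zero       = ≋-trans (≋-reflexive (⊙-e₁ S zero)) a≋x
    first-column S a≋x c≋y (suc zero) = ≋-trans (≋-reflexive (⊙-e₁ S (suc zero))) c≋y

    e₁-reaches-first-nonzero : ∀ y x₁ → Σ SL2Z λ S → S ⊙ ⟦ e₁ ⟧ ≋ᶜ ⟦ ⟨ suc y , x₁ ⟩ ⟧
    e₁-reaches-first-nonzero y x₁ with lift-suc-invertible y
    ... | u , su≋1@(mk≋ (divides k su-1≡kp)) = S , first-column S ≋-refl c≋x₁
      where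
      s t : ℤ
      s = lift (suc y)
      t = lift x₁ * u
      -- S = [[1, 0], [t, 1]] · [[s, k], [p, u]]: the right factor has determinant s u − k p = 1
      -- and sends e₁ to (s, p) ≋ (s, 0); the shear then makes the second entry t s ≋ x₁.
      S : SL2Z
      S = record
        { a = s ; b = k ; c = t * s + + p ; d = t * k + u
        ; det = trans (expand s k t u (+ p)) (trans (cong (λ e → e - k * + p + 1ℤ) su-1≡kp) (collapse (k * + p)))
        }
        where
        expand : ∀ s k t u p → s * (t * k + u) - k * (t * s + p) ≡ (s * u - 1ℤ) - k * p + 1ℤ
        expand = solve-∀
        collapse : ∀ x → x - x + 1ℤ ≡ 1ℤ
        collapse = solve-∀
      c≋x₁ : t * s + + p ≋ lift x₁
      c≋x₁ = begin
        t * s + + p          ≈⟨ +-cong (≋-refl {t * s}) modulus≋0 ⟩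
        t * s + 0ℤ           ≡⟨ rearrange (lift x₁) u s ⟩
        lift x₁ * (s * u)    ≈⟨ *-cong (≋-refl {lift x₁}) su≋1 ⟩
        lift x₁ * 1ℤ         ≡⟨ ℤₚ.*-identityʳ (lift x₁) ⟩
        lift x₁              ∎
        where
        open ≋-Reasoning
        rearrange : ∀ x u s → x * u * s + 0ℤ ≡ x * (s * u)
        rearrange = solve-∀

    e₁-reaches-second-nonzero : ∀ y → Σ SL2Z λ S → S ⊙ ⟦ e₁ ⟧ ≋ᶜ ⟦ ⟨ zero , suc y ⟩ ⟧
    e₁-reaches-second-nonzero y with lift-suc-invertible y
    ... | u , mk≋ (divides k su-1≡kp) = S , first-column S modulus≋0 ≋-refl
      where
      s : ℤ
      s = lift (suc y)
      S : SL2Z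
      S = record
        { a = + p ; b = - u ; c = s ; d = - k
        ; det = trans (expand s k u (+ p)) (trans (cong (λ e → e - k * + p + 1ℤ) su-1≡kp) (collapse (k * + p)))
        }
        where
        expand : ∀ s k u p → p * - k - - u * s ≡ (s * u - 1ℤ) - k * p + 1ℤ
        expand = solve-∀
        collapse : ∀ x → x - x + 1ℤ ≡ 1ℤ
        collapse = solve-∀

    zero-or-orbit-of-e₁ : ∀ x y → x ≡ zero × y ≡ zero ⊎ Σ SL2Z λ S → S ⊙ ⟦ e₁ ⟧ ≋ᶜ ⟦ ⟨ x , y ⟩ ⟧
    zero-or-orbit-of-e₁ zero    zero    = inj₁ (refl , refl)
    zero-or-orbit-of-e₁ (suc y) x₁      = inj₂ (e₁-reaches-first-nonzero y x₁)
    zero-or-orbit-of-e₁ zero    (suc y) = inj₂ (e₁-reaches-second-nonzero y)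

    SL₂-step : ∀ {n I J} → Transversal Full n I → Transversal Γ₁ n J → Transversal Full (suc n) (I ⊎ J)
    SL₂-step {n} {I} {J} T T₁ = record { rep = rep′ ; cover = cover′ ; separate = separate′ }
      where
      rep′ : I ⊎ J → Mat p (suc n)
      rep′ (inj₁ i) = 0ᵥ ∷ᶜ rep T i
      rep′ (inj₂ j) = e₁ ∷ᶜ rep T₁ j

      cover′ : ∀ x → Σ (I ⊎ J) λ k → Orbit Full (rep′ k) x
      cover′ x = [ zero-head , orbit-of-e₁-head ]′ (zero-or-orbit-of-e₁ (x zero zero) (x (suc zero) zero))
        where
        zero-head : x zero zero ≡ zero × x (suc zero) zero ≡ zero → Σ (I ⊎ J) λ k → Orbit Full (rep′ k) x
        zero-head (x₀₀≡0 , x₁₀≡0) = map inj₁ id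
          (cover-∷ T _ (λ {S} _ → ≋ᶜ-reflexive (⊙-0ᵥ S))
            (I₂-⊙-≗ {v = 0ᵥ} λ { zero → sym x₀₀≡0 ; (suc zero) → sym x₁₀≡0 }))
        orbit-of-e₁-head : (Σ SL2Z λ S → S ⊙ ⟦ e₁ ⟧ ≋ᶜ ⟦ ⟨ x zero zero , x (suc zero) zero ⟩ ⟧) →
                           Σ (I ⊎ J) λ k → Orbit Full (rep′ k) x
        orbit-of-e₁-head (S₀ , S₀e₁≋x₀) = map inj₂ id
          (cover-∷ T₁ _ id (≋ᶜ-trans S₀e₁≋x₀ (≋ᶜ-reflexive (cong lift ∘ ⟨,⟩-≗ refl refl))))

      zero-not-in-orbit-of-e₁ : ∀ {i j} → ¬ Orbit Full (rep′ (inj₁ i)) (rep′ (inj₂ j))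
      zero-not-in-orbit-of-e₁ (S , _ , maps) =
        contradiction (⟦⟧-injective (≋ᶜ-trans (≋ᶜ-sym (≋ᶜ-reflexive (⊙-0ᵥ S))) (maps zero)) zero) λ ()

      separate′ : ∀ k l → Orbit Full (rep′ k) (rep′ l) → k ≡ l
      separate′ (inj₁ i) (inj₁ j) o = cong inj₁ (separate T i j (orbit-tail o))
      separate′ (inj₁ _) (inj₂ _) o = contradiction o zero-not-in-orbit-of-e₁
      separate′ (inj₂ _) (inj₁ _) o = contradiction (orbit-sym _ o) zero-not-in-orbit-of-e₁
      separate′ (inj₂ i) (inj₂ j) (S , _ , maps) = cong inj₂ (separate T₁ i j (S , maps zero , maps ∘ suc))

    transversal-Γ : ∀ n → Transversal Γ n (Fin (countΓ n))
    transversal-Γ zero    = reindex Finₚ.1↔⊤ (empty-transversal λ _ → Fixes-I₂)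
    transversal-Γ (suc n) = reindex ((Finₚ.*↔× ×-↔ ↔-id _) ↔-∘ Finₚ.*↔×) (Γ-step (transversal-Γ n))

    transversal-Γ₁ : ∀ n → Transversal Γ₁ n (Fin (countΓ₁ n))
    transversal-Γ₁ zero    = reindex Finₚ.1↔⊤ (empty-transversal Fixes-I₂)
    transversal-Γ₁ (suc n) = reindex ((Finₚ.*↔× ⊎-↔ Finₚ.*↔×) ↔-∘ Finₚ.+↔⊎)
                                     (Γ₁-step (transversal-Γ₁ n) (transversal-Γ n))

    transversal-SL₂ : ∀ n → Transversal Full n (Fin (countSL₂ n))
    transversal-SL₂ zero    = reindex Finₚ.1↔⊤ (empty-transversal tt)
    transversal-SL₂ (suc n) = reindex Finₚ.+↔⊎ (SL₂-step (transversal-SL₂ n) (transversal-Γ₁ n))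

open import Data.Nat using (_+_; _*_; _∸_; _^_; _≥_)
open import Data.Nat.Tactic.RingSolver using (solve-∀)

module _ (q : ℕ) where
  open Counts (suc q)

  countΓ-closed : ∀ n → countΓ n ≡ suc q ^ n * suc q ^ n
  countΓ-closed zero    = refl
  countΓ-closed (suc n) = trans (cong (suc q * suc q *_) (countΓ-closed n)) (interchange (suc q) (suc q ^ n))
    where
    interchange : ∀ p x → p * p * (x * x) ≡ p * x * (p * x)
    interchange = solve-∀

  countΓ₁-closed : ∀ m → countΓ₁ (suc m) ≡ suc q ^ m * (suc q ^ suc m + suc q ∸ 1)
  countΓ₁-closed m = trans (closed m) (cong (λ e → suc q ^ m * (e ∸ 1)) (sym (ℕₚ.+-suc (suc q ^ suc m) q)))
    where
    base : ∀ q → (1 + q) * 1 + q * 1 ≡ 1 * ((1 + q) * 1 + q)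
    base = solve-∀
    step : ∀ q x → (1 + q) * (x * ((1 + q) * x + q)) + q * ((1 + q) * (1 + q) * (x * x))
                 ≡ (1 + q) * x * ((1 + q) * ((1 + q) * x) + q)
    step = solve-∀
    closed : ∀ m → countΓ₁ (suc m) ≡ suc q ^ m * (suc q ^ suc m + q)
    closed zero    = base q
    closed (suc m) rewrite closed m | countΓ-closed m = step q (suc q ^ m)

lemma3 : (p : ℕ) → Prime p → (n : ℕ) → n ≥ 1 →
    Σ ℕ λ r₁ → Σ ℕ λ r₂ →
      NumOrbits p n r₁ × NumOrbits p (suc n) r₂ ×
      r₂ ≡ r₁ + p ^ (n ∸ 1) * (p ^ n + p ∸ 1)
lemma3 zero          isPrime = contradiction isPrime ¬prime[0]
lemma3 (suc zero)    isPrime = contradiction isPrime ¬prime[1]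
lemma3 (suc (suc r)) isPrime (suc m) _ =
  countSL₂ (suc m) , countSL₂ (suc (suc m)) ,
  numOrbits (transversal-SL₂ (suc m)) , numOrbits (transversal-SL₂ (suc (suc m))) ,
  cong (countSL₂ (suc m) +_) (countΓ₁-closed (suc r) m)
  where
  open Counts (suc (suc r))
  open Action (suc (suc r))
  open Orbits r isPrime
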